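{- Let $S$ be a decision rule system. Then $h_{ESR}(S)\le h_{EAD}(S)\le h_{EAR}(S)\le n(S)$, $h_{SR}(S)\le h_{AD}(S)\le h_{AR}(S)$, and $h_{SR}(S)\le h_{ESR}(S)$, $h_{AD}(S)\le h_{EAD}(S)$, $h_{AR}(S)\le h_{EAR}(S)$.
   Context: Let $\omega=\{0,1,2,\dots\}$ and let $\{a_i:i\in\omega\}$ be a set of attributes. A decision rule $r$ is an expression $(a_{i_1}=\delta_1)\wedge\cdots\wedge(a_{i_m}=\delta_m)\to\sigma$ with $m\in\omega$, pairwise different attributes, and $\delta_j,\sigma\in\omega$. Its right-hand side is $\sigma$, $A(r)=\{a_{i_1},\dots,a_{i_m}\}$, and $K(r)=\{a_{i_1}=\delta_1,\dots,a_{i_m}=\delta_m\}$. Two rules are equal iff they have the same $K(\cdot)$ and the same right-hand side. A decision rule system $S$ is a finite nonempty set of decision rules. Let $A(S)=\bigcup_{r\in S}A(r)$, $n(S)=|A(S)|$, and let $D(Z)$ be the set of right-hand sides of rules in $Z\subseteq S$. For $a_i\in A(S)$, $V_S(a_i)=\{\delta:(a_i=\delta)\in\bigcup_{r\in S}K(r)\}$ and $EV_S(a_i)=V_S(a_i)\cup\{*\}$, where $*$ is a symbol not in $\omega$. A set of equations $\{a_{i_1}=\delta_1,\dots,a_{i_m}=\delta_m\}$ with $\delta_j\in\omega\cup\{*\}$ is inconsistent if there are $l\ne t$ with $i_l=i_t$ and $\delta_l\ne\delta_t$, and consistent otherwise. A decision tree over $S$ is a finite directed rooted tree with working nodes labeled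 by attributes from $A(S)$ and terminal nodes labeled by subsets of $S$. In an o-tree, a working node labeled $a_i$ has exactly $|V_S(a_i)|$ outgoing edges, labeled with pairwise distinct elements of $V_S(a_i)$. In an e-tree, it has exactly $|EV_S(a_i)|$ outgoing edges, labeled with pairwise distinct elements of $EV_S(a_i)$. For a complete path $\xi$ (root to terminal node), $K(\xi)$ is the set of equations $a_i=\delta$ with $a_i$ labeling a working node of $\xi$ and $\delta$ labeling the edge of $\xi$ leaving it. $\tau(\xi)$ is the label of the terminal node of $\xi$, and $h(\xi)$ is the number of working nodes of $\xi$. The depth $h(\Gamma)$ is the maximum of $h(\xi)$ over complete paths. An o-tree (resp. e-tree) solves $AR(S)$ (resp. $EAR(S)$) if every complete path $\xi$ with $K(\xi)$ consistent satisfies: $K(r)\subseteq K(\xi)$ for all $r\in\tau(\xi)$, and $K(r)\cup K(\xi)$ is inconsistent for all $r\in S\setminus\tau(\xi)$. It solves $AD(S)$ (resp. $EAD(S)$) if every such $\xi$ satisfies: $K(r)\subseteq K(\xi)$ for $r\in\tau(\xi)$, and $K(r)\cup K(\xi)$ is inconsistent for each $r\in S\setminus\tau(\xi)$ whose right-hand side is not in $D(\tau(\xi))$. It solves $SR(S)$ (resp. $ESR(S)$) if every such $\xi$ satisfies: $K(r)\subseteq K(\xi)$ for $r\in\tau(\xi)$, and if $\tau(\xi)=\emptyset$ then $K(r)\cup K(\xi)$ is inconsistent for all $r\in S$. For $C\in\{AR,EAR,AD,EAD,SR,ESR\}$, $h_C(S)$ is the minimum depth of a decision tree over $S$ solving $C(S)$.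 If $n(S)=0$, this is $0$. -}

module Defs where

open import Data.Nat using (ℕ; zero; suc; _⊔_; _≤_)
open import Data.Nat.Properties using (_≟_)
open import Data.Product using (Σ; ∃; ∃-syntax; _×_; _,_; proj₁; proj₂)
open import Data.Maybe using (Maybe; just; nothing)
open import Data.List using (List; []; _∷_; map; _++_; length; lookup; concatMap; deduplicate)
open import Data.List.Membership.Propositional using (_∈_; _∉_)
open import Data.List.Relation.Unary.All using (All)
open import Data.List.Relation.Unary.Any using (Any)
open import Data.List.Relation.Unary.AllPairs using (AllPairs)
open import Data.List.Relation.Unary.Unique.Propositional using (Unique)
open import Data.Fin using (Fin)
open import Data.Fin.Subset using (Subset) renaming (_∈_ to _∈ₛ_; _∉_ to _∉ₛ_)
open import Data.Unit using (⊤)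
open import Data.Empty using (⊥)
open import Relation.Nullary using (¬_)
open import Relation.Binary.PropositionalEquality using (_≡_)

-- Decision rules.  Attribute a_i is represented by its index i : ℕ.
-- An equation a_i = δ of a rule is a pair (i , δ).

record Rule : Set where
  constructor mkRule
  field
    cond : List (ℕ × ℕ)   -- the equations of K(r), listed in some order
    rhs  : ℕ
open Rule public

WFRule : Rule → Set
WFRule r = Unique (map proj₁ (cond r))

RuleEq : Rule → Rule → Set
RuleEq r r' = (∀ e → (e ∈ cond r → e ∈ cond r') × (e ∈ cond r' → e ∈ cond r))
            × rhs r ≡ rhs r'

-- A decision rule system: a finite nonempty set of rules, represented
-- by a list of well-formed, pairwise unequal rules.
IsSystem : List Rule → Set
IsSystem S = (S ≢[]) × All WFRule S × AllPairs (λ r r' → ¬ RuleEq r r') S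
  where
  _≢[] : List Rule → Set
  [] ≢[] = ⊥
  (_ ∷ _) ≢[] = ⊤

InA : List Rule → ℕ → Set
InA S i = Any (λ r → i ∈ map proj₁ (cond r)) S

nS : List Rule → ℕ
nS S = length (deduplicate _≟_ (concatMap (λ r → map proj₁ (cond r)) S))

InV : List Rule → ℕ → ℕ → Set
InV S i δ = Any (λ r → (i , δ) ∈ cond r) S

-- Extended values: ω ∪ {*}, with * represented by nothing.
EVal : Set
EVal = Maybe ℕ

InEV : List Rule → ℕ → EVal → Set
InEV S i nothing  = ⊤
InEV S i (just δ) = InV S i δ

-- Kind of tree: o-tree (ordinary) or e-tree (extended)
data Kind : Set where
  o e : Kind

Allowed : Kind → List Rule → ℕ → EVal → Set
Allowed o S i nothing  = ⊥
Allowed o S i (just δ) = InV S i δ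
Allowed e S i v        = InEV S i v

-- Decision trees (over a system with m rules; terminal labels are
-- subsets of the rules of S, given by positions in the list S).

data Tree (m : ℕ) : Set where
  leaf : Subset m → Tree m
  node : ℕ → List (EVal × Tree m) → Tree m

data WFTree (k : Kind) (S : List Rule) : Tree (length S) → Set where
  leafWF : ∀ τ → WFTree k S (leaf τ)
  nodeWF : ∀ {i es} →
           InA S i →
           Unique (map proj₁ es) →
           All (λ p → Allowed k S i (proj₁ p)) es →
           (∀ v → Allowed k S i v → v ∈ map proj₁ es) →     -- every value used (so |edges| = |V|)
           All (λ p → WFTree k S (proj₂ p)) es →
           WFTree k S (node i es)

Eqs : Set
Eqs = List (ℕ × EVal)

-- complete paths ξ: Path t K τ means a complete path with K(ξ) = K
-- (listed from the root) and τ(ξ) = τ; h(ξ) = length K.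
data Path {m : ℕ} : Tree m → Eqs → Subset m → Set where
  leafP : ∀ {τ} → Path (leaf τ) [] τ
  nodeP : ∀ {i es v t K τ} → (v , t) ∈ es → Path t K τ →
          Path (node i es) ((i , v) ∷ K) τ

mutual
  depth : ∀ {m} → Tree m → ℕ
  depth (leaf _)    = 0
  depth (node _ es) = suc (depths es)

  depths : ∀ {m} → List (EVal × Tree m) → ℕ
  depths []             = 0
  depths ((_ , t) ∷ es) = depth t ⊔ depths es

Consistent : Eqs → Set
Consistent E = ∀ {i v w} → (i , v) ∈ E → (i , w) ∈ E → v ≡ w

Inconsistent : Eqs → Set
Inconsistent E = ¬ Consistent E

KR : Rule → Eqs
KR r = map (λ p → (proj₁ p , just (proj₂ p))) (cond r)

_⊆ₑ_ : Eqs → Eqs → Set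
E ⊆ₑ F = ∀ {x} → x ∈ E → x ∈ F

data Prob : Set where
  AR AD SR : Prob

InD : (S : List Rule) → Subset (length S) → ℕ → Set
InD S τ σ = ∃[ j ] (j ∈ₛ τ × rhs (lookup S j) ≡ σ)

PathCond : Prob → (S : List Rule) → Eqs → Subset (length S) → Set
PathCond AR S K τ =
  (∀ j → j ∈ₛ τ → KR (lookup S j) ⊆ₑ K) ×
  (∀ j → j ∉ₛ τ → Inconsistent (KR (lookup S j) ++ K))
PathCond AD S K τ =
  (∀ j → j ∈ₛ τ → KR (lookup S j) ⊆ₑ K) ×
  (∀ j → j ∉ₛ τ → ¬ InD S τ (rhs (lookup S j)) → Inconsistent (KR (lookup S j) ++ K))
PathCond SR S K τ =
  (∀ j → j ∈ₛ τ → KR (lookup S j) ⊆ₑ K) ×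
  ((∀ j → j ∉ₛ τ) → ∀ j → Inconsistent (KR (lookup S j) ++ K))

-- the tree solves the problem (AR/AD/SR for o-trees, EAR/EAD/ESR for e-trees)
Solves : Prob → (S : List Rule) → Tree (length S) → Set
Solves P S t = ∀ K τ → Path t K τ → Consistent K → PathCond P S K τ

IsMinDepth : Kind → Prob → List Rule → ℕ → Set
IsMinDepth k P S d =
  (∃[ t ] (WFTree k S t × Solves P S t × depth t ≡ d)) ×
  (∀ t → WFTree k S t → Solves P S t → d ≤ depth t)

{-# OPTIONS --safe #-}
-- Whether some tree of depth at most d solves a problem below a fixed prefix of
-- equations is decidable by recursion on d: a leaf is one of finitely many
-- subsets of S, a node one of finitely many attributes of A(S).  Hence every
-- minimum depth exists, and each inequality compares sets of solving trees: a
-- tree solving AR solves AD, one solving AD solves SR, cutting the *-branches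
-- off an e-tree leaves an o-tree solving the same problem, and the e-tree that
-- queries each attribute of A(S) once and labels every leaf with the rules
-- contained in its path solves EAR with depth n(S).
module Submission where

open import Defs
open import Data.Nat using (ℕ; _≤_; zero; suc; z≤n; s≤s)
open import Data.Nat.Properties using (_≟_; ≤-trans; ≤-refl; ≤-antisym; ≰⇒>; m≤m⊔n; m≤n⊔m; ⊔-lub)
open import Data.List using (List; []; _∷_; map; _++_; length; lookup; concatMap; deduplicate; filter; [_])
open import Data.List.Properties using (++-assoc)
open import Data.Product using (∃; ∃-syntax; _×_; _,_; proj₁; proj₂)
open import Data.Product.Properties using () renaming (≡-dec to ×-≡-dec)
open import Data.Sum using (_⊎_; inj₁; inj₂; [_,_]′)
open import Data.Maybe using (just; nothing)
open import Data.Maybe.Properties using (just-injective) renaming (≡-dec to Maybe-≡-dec)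
open import Data.Unit using (tt)
open import Data.Fin using (Fin)
open import Data.Fin.Subset using (Subset) renaming (_∈_ to _∈ₛ_; _∉_ to _∉ₛ_)
open import Data.Fin.Subset.Properties using (anySubset?) renaming (_∈?_ to _∈ₛ?_)
open import Data.Fin.Properties using (all?; any?)
open import Data.Vec using (tabulate)
open import Data.Vec.Properties using (lookup∘tabulate; []=⇒lookup; lookup⇒[]=)
open import Data.List.Membership.Propositional using (_∈_; lose; find)
open import Data.List.Membership.Propositional.Properties
  using (∈-deduplicate⁻; ∈-deduplicate⁺; ∈-map⁻; ∈-map⁺; ∈-filter⁺; ∈-filter⁻; ∈-concatMap⁺; ∈-concatMap⁻; ∈-++⁺ˡ; ∈-++⁺ʳ; ∈-lookup)
open import Data.List.Relation.Unary.All as All using (All; []; _∷_)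
open import Data.List.Relation.Unary.All.Properties using (¬All⇒Any¬) renaming (map⁺ to All-map⁺; map⁻ to All-map⁻)
open import Data.List.Relation.Unary.Any as Any using (here; there)
open import Data.List.Relation.Unary.AllPairs using (_∷_)
open import Data.List.Relation.Unary.Unique.Propositional using (Unique)
open import Data.List.Relation.Unary.Unique.Propositional.Properties using () renaming (map⁺ to Unique-map⁺)
open import Data.List.Relation.Unary.Unique.DecPropositional.Properties _≟_ using (deduplicate-!)
open import Relation.Binary.Definitions using (DecidableEquality)
open import Relation.Nullary using (¬_; Dec; yes; no; does)
open import Relation.Nullary.Decidable using (map′; dec-true; _×-dec_; _→-dec_; ¬?)
open import Relation.Binary.PropositionalEquality using (_≡_; refl; sym; trans; subst; cong)

_≟ₑ_ : DecidableEquality (ℕ × EVal)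
_≟ₑ_ = ×-≡-dec _≟_ (Maybe-≡-dec _≟_)

open import Data.List.Relation.Binary.Subset.DecPropositional _≟ₑ_ using (_⊆?_)
open import Data.List.Membership.DecPropositional _≟ₑ_ using (_∈?_)

consistent? : (E : Eqs) → Dec (Consistent E)
consistent? E = map′ (λ a p q → All.lookup (All.lookup a p) q refl)
                     (λ c → All.tabulate λ p → All.tabulate λ q → agree c p q)
                     (All.all? (λ x → All.all? (λ y → (proj₁ x ≟ proj₁ y) →-dec Maybe-≡-dec _≟_ (proj₂ x) (proj₂ y)) E) E)
  where
  agree : Consistent E → ∀ {x y} → x ∈ E → y ∈ E → proj₁ x ≡ proj₁ y → proj₂ x ≡ proj₂ y
  agree c p q refl = c p q

pathCond? : ∀ P S K τ → Dec (PathCond P S K τ)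
pathCond? AR S K τ =
  all? (λ j → (j ∈ₛ? τ) →-dec (KR (lookup S j) ⊆? K))
  ×-dec all? (λ j → ¬? (j ∈ₛ? τ) →-dec ¬? (consistent? (KR (lookup S j) ++ K)))
pathCond? AD S K τ =
  all? (λ j → (j ∈ₛ? τ) →-dec (KR (lookup S j) ⊆? K))
  ×-dec all? (λ j → ¬? (j ∈ₛ? τ)
                    →-dec ¬? (any? λ j′ → (j′ ∈ₛ? τ) ×-dec (rhs (lookup S j′) ≟ rhs (lookup S j)))
                    →-dec ¬? (consistent? (KR (lookup S j) ++ K)))
pathCond? SR S K τ =
  all? (λ j → (j ∈ₛ? τ) →-dec (KR (lookup S j) ⊆? K))
  ×-dec (all? (λ j → ¬? (j ∈ₛ? τ)) →-dec all? (λ j → ¬? (consistent? (KR (lookup S j) ++ K))))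

select : ∀ {n} {P : Fin n → Set} → (∀ j → Dec (P j)) → Subset n
select P? = tabulate λ j → does (P? j)

module _ {n} {P : Fin n → Set} (P? : ∀ j → Dec (P j)) {j : Fin n} where

  ∈-select⁺ : P j → j ∈ₛ select P?
  ∈-select⁺ p = lookup⇒[]= j _ (trans (lookup∘tabulate _ j) (dec-true (P? j) p))

  ∈-select⁻ : j ∈ₛ select P? → P j
  ∈-select⁻ j∈ with P? j | trans (sym (lookup∘tabulate _ j)) ([]=⇒lookup j∈)
  ... | yes p | _ = p
  ... | no _  | ()

rulesContainedIn : (S : List Rule) → Eqs → Subset (length S)
rulesContainedIn S K = select λ j → KR (lookup S j) ⊆? K

-- Once K assigns a value to every attribute of S, a rule not contained in K
-- disagrees with K on one of its attributes.
rulesContainedIn-solves-AR : ∀ S K → (∀ i → InA S i → ∃[ w ] (i , w) ∈ K) →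
                             PathCond AR S K (rulesContainedIn S K)
rulesContainedIn-solves-AR S K queried = (λ _ → ∈-select⁻ P?) , outside
  where
  P? = λ j → KR (lookup S j) ⊆? K

  outside : ∀ j → j ∉ₛ rulesContainedIn S K → Inconsistent (KR (lookup S j) ++ K)
  outside j j∉τ consistent
    with find (¬All⇒Any¬ (_∈? K) _ (λ sub → j∉τ (∈-select⁺ P? (All.lookup sub))))
  ... | x , x∈r , x∉K with ∈-map⁻ _ x∈r
  ... | (a , δ) , aδ∈r , refl with queried a (lose (∈-lookup j) (∈-map⁺ proj₁ aδ∈r))
  ... | w , aw∈K with consistent (∈-++⁺ˡ x∈r) (∈-++⁺ʳ (KR (lookup S j)) aw∈K)
  ... | refl = x∉K aw∈K

attributes : List Rule → List ℕ
attributes = concatMap λ r → map proj₁ (cond r)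

values : List Rule → ℕ → List ℕ
values S i = deduplicate _≟_ (map proj₂ (filter (λ x → proj₁ x ≟ i) (concatMap cond S)))

∈-values⁺ : ∀ {S i δ} → InV S i δ → δ ∈ values S i
∈-values⁺ {i = i} p = ∈-deduplicate⁺ _≟_ (∈-map⁺ proj₂ (∈-filter⁺ (λ x → proj₁ x ≟ i) (∈-concatMap⁺ cond p) refl))

∈-values⁻ : ∀ {S i δ} → δ ∈ values S i → InV S i δ
∈-values⁻ {i = i} p with ∈-map⁻ proj₂ (∈-deduplicate⁻ _≟_ _ p)
... | (a , _) , q , refl with ∈-filter⁻ (λ x → proj₁ x ≟ i) q
... | e∈S , refl = ∈-concatMap⁻ cond e∈S

edgeLabels : Kind → List Rule → ℕ → List EVal
edgeLabels o S i = map just (values S i)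
edgeLabels e S i = nothing ∷ map just (values S i)

edgeLabels-allowed : ∀ k S i → All (Allowed k S i) (edgeLabels k S i)
edgeLabels-allowed o S i = All-map⁺ (All.tabulate ∈-values⁻)
edgeLabels-allowed e S i = tt ∷ All-map⁺ (All.tabulate ∈-values⁻)

allowed⇒∈-edgeLabels : ∀ k S i v → Allowed k S i v → v ∈ edgeLabels k S i
allowed⇒∈-edgeLabels o S i (just δ) p = ∈-map⁺ just (∈-values⁺ p)
allowed⇒∈-edgeLabels e S i nothing  _ = here refl
allowed⇒∈-edgeLabels e S i (just δ) p = there (∈-map⁺ just (∈-values⁺ p))

edgeLabels-unique : ∀ k S i → Unique (edgeLabels k S i)
edgeLabels-unique o S i = Unique-map⁺ just-injective (deduplicate-! _)
edgeLabels-unique e S i = All-map⁺ (All.tabulate λ _ ()) ∷ Unique-map⁺ just-injective (deduplicate-! _)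

Allowed-o⇒e : ∀ {S i} v → Allowed o S i v → Allowed e S i v
Allowed-o⇒e (just δ) p = p

depth-∈ : ∀ {m v} {t : Tree m} {es} → (v , t) ∈ es → depth t ≤ depths es
depth-∈ {es = (_ , t) ∷ es} (here refl) = m≤m⊔n (depth t) (depths es)
depth-∈ {es = (_ , t) ∷ es} (there p)   = ≤-trans (depth-∈ p) (m≤n⊔m (depth t) (depths es))

depths-≤ : ∀ {m d} {es : List (EVal × Tree m)} → All (λ e → depth (proj₂ e) ≤ d) es → depths es ≤ d
depths-≤ []       = z≤n
depths-≤ (p ∷ ps) = ⊔-lub p (depths-≤ ps)

least-upward-closed : {Q : ℕ → Set} → (∀ d → Dec (Q d)) → (∀ {d d′} → d ≤ d′ → Q d → Q d′) →
                      ∀ b → Q b → ∃[ h ] (Q h × ∀ d → Q d → h ≤ d)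
least-upward-closed Q? up zero    q = zero , q , λ _ _ → z≤n
least-upward-closed Q? up (suc b) q with Q? b
... | yes q′ = least-upward-closed Q? up b q′
... | no ¬q′ = suc b , q , λ d q-d → ≰⇒> λ d≤b → ¬q′ (up d≤b q-d)

module _ (S : List Rule) where

  PathCond-AR⇒AD : ∀ {K τ} → PathCond AR S K τ → PathCond AD S K τ
  PathCond-AR⇒AD (sub , incons) = sub , λ j j∉τ _ → incons j j∉τ

  PathCond-AD⇒SR : ∀ {K τ} → PathCond AD S K τ → PathCond SR S K τ
  PathCond-AD⇒SR (sub , incons) = sub , λ τ-empty j → incons j (τ-empty j) λ (j′ , j′∈τ , _) → τ-empty j′ j′∈τ

  PathCond-AR⇒ : ∀ {K τ} P → PathCond AR S K τ → PathCond P S K τ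
  PathCond-AR⇒ AR c = c
  PathCond-AR⇒ AD c = PathCond-AR⇒AD c
  PathCond-AR⇒ SR c = PathCond-AD⇒SR (PathCond-AR⇒AD c)

  SolvesAfter : Prob → Eqs → Tree (length S) → Set
  SolvesAfter P Pre t = ∀ K τ → Path t K τ → Consistent (Pre ++ K) → PathCond P S (Pre ++ K) τ

  record Solvable (k : Kind) (P : Prob) (Pre : Eqs) (d : ℕ) : Set where
    constructor solvedBy
    field
      tree   : Tree (length S)
      wf     : WFTree k S tree
      depth≤ : depth tree ≤ d
      solves : SolvesAfter P Pre tree

  LeafSolves : Prob → Eqs → Subset (length S) → Set
  LeafSolves P Pre τ = Consistent (Pre ++ []) → PathCond P S (Pre ++ []) τ

  leafSolves? : ∀ P Pre → Dec (∃ (LeafSolves P Pre))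
  leafSolves? P Pre = anySubset? λ τ → consistent? (Pre ++ []) →-dec pathCond? P S (Pre ++ []) τ

  solvesAfter-child : ∀ {P Pre i v t es} → (v , t) ∈ es →
                      SolvesAfter P Pre (node i es) → SolvesAfter P (Pre ++ [ (i , v) ]) t
  solvesAfter-child {P} {Pre} {i} {v} v,t∈es solves K τ path c =
    subst (λ X → PathCond P S X τ) (sym (++-assoc Pre [ (i , v) ] K))
      (solves _ τ (nodeP v,t∈es path) (subst Consistent (++-assoc Pre [ (i , v) ] K) c))

  solvesAfter-node : ∀ {P Pre i es} →
                     (∀ {v t} → (v , t) ∈ es → SolvesAfter P (Pre ++ [ (i , v) ]) t) →
                     SolvesAfter P Pre (node i es)
  solvesAfter-node {P} {Pre} {i} children _ τ (nodeP {v = v} {K = K} v,t∈es path) c =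
    subst (λ X → PathCond P S X τ) (++-assoc Pre [ (i , v) ] K)
      (children v,t∈es K τ path (subst Consistent (sym (++-assoc Pre [ (i , v) ] K)) c))

  solvable-leaf : ∀ {k P Pre d τ} → LeafSolves P Pre τ → Solvable k P Pre d
  solvable-leaf {τ = τ} ok = solvedBy (leaf τ) (leafWF τ) z≤n λ { .[] .τ leafP → ok }

  solvable-zero : ∀ {k P Pre} → Solvable k P Pre 0 → ∃ (LeafSolves P Pre)
  solvable-zero (solvedBy (leaf τ) _ _ solves) = τ , solves [] τ leafP

  module Graft (k : Kind) (P : Prob) (Pre : Eqs) (d i : ℕ) where

    graft : ∀ vs → All (λ v → Solvable k P (Pre ++ [ (i , v) ]) d) vs → List (EVal × Tree (length S))
    graft []       []                             = []
    graft (v ∷ vs) (solvedBy t _ _ _ ∷ subtrees) = (v , t) ∷ graft vs subtrees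

    graft-labels : ∀ vs (subtrees : All (λ v → Solvable k P (Pre ++ [ (i , v) ]) d) vs) →
                   map proj₁ (graft vs subtrees) ≡ vs
    graft-labels []       []             = refl
    graft-labels (v ∷ vs) (_ ∷ subtrees) = cong (v ∷_) (graft-labels vs subtrees)

    graft-solvable : ∀ vs (subtrees : All (λ v → Solvable k P (Pre ++ [ (i , v) ]) d) vs) →
                     All (λ (v , t) → WFTree k S t × depth t ≤ d × SolvesAfter P (Pre ++ [ (i , v) ]) t)
                         (graft vs subtrees)
    graft-solvable []       []                                     = []
    graft-solvable (v ∷ vs) (solvedBy _ wf depth≤ solves ∷ subtrees) =
      (wf , depth≤ , solves) ∷ graft-solvable vs subtrees

  solvable-node : ∀ {k P Pre d i} → InA S i →
                  All (λ v → Solvable k P (Pre ++ [ (i , v) ]) d) (edgeLabels k S i) →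
                  Solvable k P Pre (suc d)
  solvable-node {k} {P} {Pre} {d} {i} i∈A subtrees =
    solvedBy (node i es) (nodeWF i∈A unique allowed covers (All.map proj₁ solvable))
      (s≤s (depths-≤ (All.map (λ s → proj₁ (proj₂ s)) solvable)))
      (solvesAfter-node λ v,t∈es → proj₂ (proj₂ (All.lookup solvable v,t∈es)))
    where
    open Graft k P Pre d i
    es = graft (edgeLabels k S i) subtrees
    solvable = graft-solvable (edgeLabels k S i) subtrees
    labels : map proj₁ es ≡ edgeLabels k S i
    labels = graft-labels (edgeLabels k S i) subtrees
    unique = subst Unique (sym labels) (edgeLabels-unique k S i)
    allowed = All-map⁻ (subst (All (Allowed k S i)) (sym labels) (edgeLabels-allowed k S i))
    covers : ∀ v → Allowed k S i v → v ∈ map proj₁ es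
    covers v p = subst (v ∈_) (sym labels) (allowed⇒∈-edgeLabels k S i v p)

  leaf-or-node : ∀ {k P Pre d} → Solvable k P Pre (suc d) →
                 ∃ (LeafSolves P Pre) ⊎
                 ∃[ i ] (InA S i × (∀ v → Allowed k S i v → Solvable k P (Pre ++ [ (i , v) ]) d))
  leaf-or-node (solvedBy (leaf τ) _ _ solves) = inj₁ (τ , solves [] τ leafP)
  leaf-or-node {k} {P} {Pre} {d} (solvedBy (node i es) (nodeWF i∈A _ _ covers wf) (s≤s depth≤) solves) =
    inj₂ (i , i∈A , child)
    where
    child : ∀ v → Allowed k S i v → Solvable k P (Pre ++ [ (i , v) ]) d
    child v allowed with ∈-map⁻ proj₁ (covers v allowed)
    ... | (.v , t) , v,t∈es , refl =
      solvedBy t (All.lookup wf v,t∈es) (≤-trans (depth-∈ v,t∈es) depth≤) (solvesAfter-child v,t∈es solves)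

  solvable? : ∀ k P Pre d → Dec (Solvable k P Pre d)
  solvable? k P Pre zero with leafSolves? P Pre
  ... | yes (_ , ok) = yes (solvable-leaf ok)
  ... | no ¬leaf     = no λ s → ¬leaf (solvable-zero s)
  solvable? k P Pre (suc d) with leafSolves? P Pre
  ... | yes (_ , ok) = yes (solvable-leaf ok)
  ... | no ¬leaf with Any.any? (λ i → All.all? (λ v → solvable? k P (Pre ++ [ (i , v) ]) d) (edgeLabels k S i))
                               (attributes S)
  ...   | yes split = let i , i∈attrs , subtrees = find split in
                      yes (solvable-node (∈-concatMap⁻ _ i∈attrs) subtrees)
  ...   | no ¬split = no λ s → [ ¬leaf , ¬node ]′ (leaf-or-node s)
    where
    ¬node : ¬ (∃[ i ] (InA S i × (∀ v → Allowed k S i v → Solvable k P (Pre ++ [ (i , v) ]) d)))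
    ¬node (i , i∈A , children) = ¬split (lose (∈-concatMap⁺ _ i∈A)
      (All.tabulate λ v∈ → children _ (All.lookup (edgeLabels-allowed k S i) v∈)))

  solvable-mono : ∀ {k P Pre d d′} → d ≤ d′ → Solvable k P Pre d → Solvable k P Pre d′
  solvable-mono d≤d′ (solvedBy t wf depth≤ solves) = solvedBy t wf (≤-trans depth≤ d≤d′) solves

  solvable-weaken : ∀ {k P P′ Pre d} → (∀ {K τ} → PathCond P S K τ → PathCond P′ S K τ) →
                    Solvable k P Pre d → Solvable k P′ Pre d
  solvable-weaken P⇒P′ (solvedBy t wf depth≤ solves) = solvedBy t wf depth≤ λ K τ path c → P⇒P′ (solves K τ path c)

  -- Cutting off the *-branches turns an e-tree into an o-tree.
  solvable-e⇒o : ∀ {P} d Pre → Solvable e P Pre d → Solvable o P Pre d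
  solvable-e⇒o zero    Pre s = solvable-leaf (proj₂ (solvable-zero s))
  solvable-e⇒o (suc d) Pre s with leaf-or-node s
  ... | inj₁ (_ , ok)             = solvable-leaf ok
  ... | inj₂ (i , i∈A , children) = solvable-node i∈A (All.tabulate λ {v} v∈ →
          solvable-e⇒o d _ (children v (Allowed-o⇒e v (All.lookup (edgeLabels-allowed o S i) v∈))))

  solvable-AR-querying : ∀ {k} L → All (InA S) L → ∀ Pre →
                         (∀ i → InA S i → i ∈ L ⊎ ∃[ w ] (i , w) ∈ Pre) →
                         Solvable k AR Pre (length L)
  solvable-AR-querying [] _ Pre covered =
    solvable-leaf {P = AR} λ _ → rulesContainedIn-solves-AR S (Pre ++ [])
      λ i i∈A → [ (λ ()) , (λ (w , i,w∈Pre) → w , ∈-++⁺ˡ i,w∈Pre) ]′ (covered i i∈A)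
  solvable-AR-querying (a ∷ L) (a∈A ∷ L⊆A) Pre covered =
    solvable-node {P = AR} a∈A (All.tabulate λ {v} _ → solvable-AR-querying L L⊆A (Pre ++ [ (a , v) ]) (covered′ v))
    where
    covered′ : ∀ v i → InA S i → i ∈ L ⊎ ∃[ w ] (i , w) ∈ Pre ++ [ (a , v) ]
    covered′ v i i∈A with covered i i∈A
    ... | inj₁ (here refl)       = inj₂ (v , ∈-++⁺ʳ Pre (here refl))
    ... | inj₁ (there i∈L)       = inj₁ i∈L
    ... | inj₂ (w , i,w∈Pre)     = inj₂ (w , ∈-++⁺ˡ i,w∈Pre)

  solvable-nS : ∀ k P → Solvable k P [] (nS S)
  solvable-nS k P = solvable-weaken (PathCond-AR⇒ P)
    (solvable-AR-querying (deduplicate _≟_ (attributes S))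
      (All.tabulate λ i∈ → ∈-concatMap⁻ _ (∈-deduplicate⁻ _≟_ _ i∈)) []
      λ i i∈A → inj₁ (∈-deduplicate⁺ _≟_ (∈-concatMap⁺ _ i∈A)))

  minDepth : ∀ k P → ∃ (IsMinDepth k P S)
  minDepth k P with least-upward-closed (solvable? k P []) solvable-mono (nS S) (solvable-nS k P)
  ... | h , solvedBy t wf depth≤ solves , least =
    h , (t , wf , solves , ≤-antisym depth≤ (least _ (solvedBy t wf ≤-refl solves))) ,
    λ t′ wf′ solves′ → least _ (solvedBy t′ wf′ ≤-refl solves′)

  minDepth-solvable : ∀ {k P h} → IsMinDepth k P S h → Solvable k P [] h
  minDepth-solvable ((t , wf , solves , refl) , _) = solvedBy t wf ≤-refl solves

  minDepth-≤ : ∀ {k P h d} → IsMinDepth k P S h → Solvable k P [] d → h ≤ d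
  minDepth-≤ (_ , least) (solvedBy t wf depth≤ solves) = ≤-trans (least t wf solves) depth≤

lemma3 : (S : List Rule) → IsSystem S →
    ∃[ hSR ] ∃[ hAD ] ∃[ hAR ] ∃[ hESR ] ∃[ hEAD ] ∃[ hEAR ]
      ( IsMinDepth o SR S hSR × IsMinDepth o AD S hAD × IsMinDepth o AR S hAR
      × IsMinDepth e SR S hESR × IsMinDepth e AD S hEAD × IsMinDepth e AR S hEAR
      × hESR ≤ hEAD × hEAD ≤ hEAR × hEAR ≤ nS S
      × hSR ≤ hAD × hAD ≤ hAR
      × hSR ≤ hESR × hAD ≤ hEAD × hAR ≤ hEAR )
lemma3 S _ =
  h o SR , h o AD , h o AR , h e SR , h e AD , h e AR ,
  isMin o SR , isMin o AD , isMin o AR , isMin e SR , isMin e AD , isMin e AR ,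
  h≤ e SR (solvable-weaken S (PathCond-AD⇒SR S) (optimal e AD)) ,
  h≤ e AD (solvable-weaken S (PathCond-AR⇒AD S) (optimal e AR)) ,
  h≤ e AR (solvable-nS S e AR) ,
  h≤ o SR (solvable-weaken S (PathCond-AD⇒SR S) (optimal o AD)) ,
  h≤ o AD (solvable-weaken S (PathCond-AR⇒AD S) (optimal o AR)) ,
  h≤ o SR (solvable-e⇒o S _ [] (optimal e SR)) ,
  h≤ o AD (solvable-e⇒o S _ [] (optimal e AD)) ,
  h≤ o AR (solvable-e⇒o S _ [] (optimal e AR))
  where
  h : Kind → Prob → ℕ
  h k P = proj₁ (minDepth S k P)

  isMin : ∀ k P → IsMinDepth k P S (h k P)
  isMin k P = proj₂ (minDepth S k P)

  optimal : ∀ k P → Solvable S k P [] (h k P)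
  optimal k P = minDepth-solvable S {k} {P} (isMin k P)

  h≤ : ∀ k P {d} → Solvable S k P [] d → h k P ≤ d
  h≤ k P = minDepth-≤ S {k} {P} (isMin k P)
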